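{- Let $G\in\mathcal E$ and suppose $A$ is a Left option of $G$ that is end-reversible modulo $\mathcal E$. (1) If $A$ is not a fundamental Left option of $G$ and $\{G^{\mathcal L}\setminus\{A\}\mid G^{\mathcal R}\}\in\mathcal E$, then $G\equiv_{\mathcal E}\{G^{\mathcal L}\setminus\{A\}\mid G^{\mathcal R}\}$. (2) If $G=\{A\mid C\}$ (i.e. $A$ is the only Left option and $C$ the only Right option of $G$), where $C$ is also end-reversible modulo $\mathcal E$, then $G\equiv_{\mathcal E}\mathbf 0$.
   Context: All games are short two-player partizan games between Left and Right, identified with their game trees: $G=\{G^{\mathcal L}\mid G^{\mathcal R}\}$ with finite sets of options; $\mathbf 0=\{\;\mid\;\}$. Followers of $G$: $G$, its options, their options, etc. Disjunctive sum: $G+H=\{G^{\mathcal L}+H,G+H^{\mathcal L}\mid G^{\mathcal R}+H,G+H^{\mathcal R}\}$. Misère play: a player with no move on their turn wins. $o_L(G)=\mathrm L$ if $G^{\mathcal L}=\emptyset$, else $\max_{G^L}o_R(G^L)$; $o_R(G)=\mathrm R$ if $G^{\mathcal R}=\emptyset$, else $\min_{G^R}o_L(G^R)$; $\mathrm L>\mathrm R$; $o(G)=(o_L(G),o_R(G))$ ordered componentwise. A Left-end has no Left option; a dead Left-end has only Left-ends as followers; similarly Right. A game is dead-ending if each follower that is a Left-end (Right-end) is a dead Left-end (dead Right-end); $\mathcal E$ is the class of dead-ending games. $G\geq_{\mathcal E}H$ means $o(G+X)\geq o(H+X)$ for all $X\in\mathcal E$; $\equiv_{\mathcal E}$ means both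 directions. A Left option $A$ of $G$ is end-reversible (modulo $\mathcal E$) if $A$ has a Right option $B$ with no Left options and $B\leq_{\mathcal E}G$; a Right option $C$ of $G$ is end-reversible if $C$ has a Left option $D$ with no Right options and $D\geq_{\mathcal E}G$. Strong outcomes: $\hat o_L(K)=\min\{o_L(K+X):X\in\mathcal E\text{ a Left-end}\}$, $\hat o_R(K)=\max\{o_R(K+Y):Y\in\mathcal E\text{ a Right-end}\}$ (defined for any game $K$). A Left option $A$ of $G$ is fundamental if $\hat o_L(G)=\mathrm L$ and $\hat o_L(\{G^{\mathcal L}\setminus\{A\}\mid G^{\mathcal R}\})=\mathrm R$. -}

module Defs where

open import Data.List using (List; []; _∷_; _++_; filter)
open import Data.List.Membership.Propositional using (_∈_)
open import Data.Product using (Σ; _×_; _,_; ∃)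
open import Relation.Binary.PropositionalEquality using (_≡_; refl; cong; cong₂)
open import Relation.Nullary using (Dec; yes; no; ¬_; ¬?)
open import Relation.Nullary.Decidable using (map′)
open import Data.Empty using (⊥)

-- Short games as game trees; options stored as finite lists
-- (order / repetition are irrelevant for every notion below).

data Game : Set where
  ⟨_∣_⟩ : List Game → List Game → Game

leftOpts : Game → List Game
leftOpts ⟨ L ∣ R ⟩ = L

rightOpts : Game → List Game
rightOpts ⟨ L ∣ R ⟩ = R

𝟎 : Game
𝟎 = ⟨ [] ∣ [] ⟩

mutual
  _≟G_ : (G H : Game) → Dec (G ≡ H)
  ⟨ L ∣ R ⟩ ≟G ⟨ L' ∣ R' ⟩ with L ≟Gs L' | R ≟Gs R'
  ... | yes refl | yes refl = yes refl
  ... | no ne    | _        = no λ { refl → ne refl }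
  ... | yes _    | no ne    = no λ { refl → ne refl }

  _≟Gs_ : (xs ys : List Game) → Dec (xs ≡ ys)
  [] ≟Gs [] = yes refl
  [] ≟Gs (_ ∷ _) = no λ ()
  (_ ∷ _) ≟Gs [] = no λ ()
  (x ∷ xs) ≟Gs (y ∷ ys) with x ≟G y | xs ≟Gs ys
  ... | yes refl | yes refl = yes refl
  ... | no ne    | _        = no λ { refl → ne refl }
  ... | yes _    | no ne    = no λ { refl → ne refl }

removeLeft : Game → Game → Game
removeLeft ⟨ L ∣ R ⟩ A = ⟨ filter (λ x → ¬? (x ≟G A)) L ∣ R ⟩

mutual
  _+G_ : Game → Game → Game
  ⟨ GL ∣ GR ⟩ +G H@(⟨ HL ∣ HR ⟩) =
    ⟨ addEach GL H ++ addTo ⟨ GL ∣ GR ⟩ HL ∣ addEach GR H ++ addTo ⟨ GL ∣ GR ⟩ HR ⟩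

  addEach : List Game → Game → List Game
  addEach [] H = []
  addEach (x ∷ xs) H = (x +G H) ∷ addEach xs H

  addTo : Game → List Game → List Game
  addTo G [] = []
  addTo G (y ∷ ys) = (G +G y) ∷ addTo G ys

data Player : Set where
  L R : Player

data _≤P_ : Player → Player → Set where
  R≤ : ∀ {p} → R ≤P p
  L≤L : L ≤P L

_⊔_ : Player → Player → Player
L ⊔ _ = L
R ⊔ q = q

_⊓_ : Player → Player → Player
R ⊓ _ = R
L ⊓ q = q

mutual
  oL : Game → Player
  oL ⟨ [] ∣ _ ⟩ = L
  oL ⟨ x ∷ xs ∣ _ ⟩ = maxOR (x ∷ xs)

  oR : Game → Player
  oR ⟨ _ ∣ [] ⟩ = R
  oR ⟨ _ ∣ x ∷ xs ⟩ = minOL (x ∷ xs)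

  -- max of oR over a (nonempty, when used) list
  maxOR : List Game → Player
  maxOR [] = R
  maxOR (x ∷ xs) = oR x ⊔ maxOR xs

  -- min of oL over a (nonempty, when used) list
  minOL : List Game → Player
  minOL [] = L
  minOL (x ∷ xs) = oL x ⊓ minOL xs

_≤o_ : Game → Game → Set
G ≤o H = (oL G ≤P oL H) × (oR G ≤P oR H)

data Follower : Game → Game → Set where
  self  : ∀ {G} → Follower G G
  viaL  : ∀ {G H K} → K ∈ leftOpts G → Follower H K → Follower H G
  viaR  : ∀ {G H K} → K ∈ rightOpts G → Follower H K → Follower H G

LeftEnd : Game → Set
LeftEnd G = leftOpts G ≡ []

RightEnd : Game → Set
RightEnd G = rightOpts G ≡ []

DeadLeftEnd : Game → Set
DeadLeftEnd G = ∀ H → Follower H G → LeftEnd H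

DeadRightEnd : Game → Set
DeadRightEnd G = ∀ H → Follower H G → RightEnd H

DeadEnding : Game → Set
DeadEnding G = ∀ H → Follower H G →
  (LeftEnd H → DeadLeftEnd H) × (RightEnd H → DeadRightEnd H)

_≥E_ : Game → Game → Set
G ≥E H = ∀ X → DeadEnding X → (H +G X) ≤o (G +G X)

_≤E_ : Game → Game → Set
G ≤E H = H ≥E G

_≡E_ : Game → Game → Set
G ≡E H = (G ≥E H) × (H ≥E G)

EndReversibleL : Game → Game → Set
EndReversibleL G A = (A ∈ leftOpts G) ×
  Σ Game (λ B → (B ∈ rightOpts A) × LeftEnd B × (B ≤E G))

EndReversibleR : Game → Game → Set
EndReversibleR G C = (C ∈ rightOpts G) ×
  Σ Game (λ D → (D ∈ leftOpts C) × RightEnd D × (D ≥E G))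

-- Strong Left outcome:  ô_L(K) = min { o_L(K+X) : X ∈ E a Left-end }.
-- As outcomes lie in {R < L}, ô_L(K) = L iff every such o_L(K+X) = L,
-- and ô_L(K) = R iff some such o_L(K+X) = R.

StrongOL≡L : Game → Set
StrongOL≡L K = ∀ X → DeadEnding X → LeftEnd X → oL (K +G X) ≡ L

StrongOL≡R : Game → Set
StrongOL≡R K = ∃ λ X → DeadEnding X × LeftEnd X × (oL (K +G X) ≡ R)

Fundamental : Game → Game → Set
Fundamental G A = (A ∈ leftOpts G) × StrongOL≡L G × StrongOL≡R (removeLeft G A)

module Submission where

-- To show G ≡E H we prove o(G + X) = o(H + X) for every dead-ending X,
-- by structural induction on X: the Left (Right) outcome of G + X is
-- determined by the Right (Left) outcomes of the Left (Right) options, so it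
-- suffices to compare the first moves, assuming the claim for the options of X
-- (`≡E-by-induction`).  The heart of the proof is a single step lemma
-- (`deleteReversibleLeft`): if H is G with an end-reversible Left option A
-- deleted (A reversed through the Left-end B ≤E G), then a winning move A + X
-- in G + X can be answered by Right's move to B + X, from where Left can only
-- move in X, to B + x; since B ≤E G this transfers to G + x, hence, by the
-- induction hypothesis, to H + x.  The only case this misses is X a Left-end,
-- where we need the strong Left outcome of H to be L.  In part (1) this comes
-- from A not being fundamental, and the right side is untouched; in part (2)
-- H = 0, and both options of G = {A | C} are deleted by the step lemma and its
-- mirror image `deleteReversibleRight`.  The argument never uses that G or
-- {G^L \ A | G^R} is itself dead-ending.

open import Defs
open import Data.List using (List; []; _∷_; _++_; map)
open import Data.List.Membership.Propositional using (_∈_; _∉_)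
open import Data.List.Membership.Propositional.Properties
  using (∈-++⁺ˡ; ∈-++⁺ʳ; ∈-++⁻; ∈-map⁺; ∈-map⁻; ∈-filter⁺)
open import Data.List.Relation.Binary.Subset.Propositional using (_⊆_)
open import Data.List.Relation.Binary.Subset.Propositional.Properties using (filter-⊆)
open import Data.List.Relation.Unary.Any using (here; there)
open import Data.Product using (_×_; _,_; proj₁; proj₂; ∃)
open import Data.Sum using (inj₁; inj₂)
open import Data.Empty using (⊥-elim)
open import Relation.Binary.PropositionalEquality using (_≡_; refl; sym; trans; cong₂; subst)
open import Relation.Nullary using (¬_; ¬?; yes; no)

L-ext : ∀ {p q} → (p ≡ L → q ≡ L) → (q ≡ L → p ≡ L) → p ≡ q
L-ext {L} {L} _ _ = refl
L-ext {R} {R} _ _ = refl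
L-ext {L} {R} to _ with () ← to refl
L-ext {R} {L} _ from with () ← from refl

R-ext : ∀ {p q} → (p ≡ R → q ≡ R) → (q ≡ R → p ≡ R) → p ≡ q
R-ext {L} {L} _ _ = refl
R-ext {R} {R} _ _ = refl
R-ext {L} {R} _ from with () ← from refl
R-ext {R} {L} to _ with () ← to refl

≡⇒≤P : ∀ {p q} → p ≡ q → p ≤P q
≡⇒≤P {L} refl = L≤L
≡⇒≤P {R} refl = R≤

≤P-L : ∀ {p q} → p ≤P q → p ≡ L → q ≡ L
≤P-L L≤L _ = refl

≤P-R : ∀ {p q} → p ≤P q → q ≡ R → p ≡ R
≤P-R R≤ _ = refl

noOption : ∀ {xs : List Game} {x} → xs ≡ [] → x ∉ xs
noOption refl ()

maxOR≡L-intro : ∀ {x} xs → x ∈ xs → oR x ≡ L → maxOR xs ≡ L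
maxOR≡L-intro (y ∷ ys) (here refl) w rewrite w = refl
maxOR≡L-intro (y ∷ ys) (there m) w with oR y
... | L = refl
... | R = maxOR≡L-intro ys m w

maxOR≡L-elim : ∀ xs → maxOR xs ≡ L → ∃ λ x → x ∈ xs × oR x ≡ L
maxOR≡L-elim (y ∷ ys) e with oR y in w
... | L = y , here refl , w
... | R with x , m , w′ ← maxOR≡L-elim ys e = x , there m , w′

minOL≡R-intro : ∀ {x} xs → x ∈ xs → oL x ≡ R → minOL xs ≡ R
minOL≡R-intro (y ∷ ys) (here refl) w rewrite w = refl
minOL≡R-intro (y ∷ ys) (there m) w with oL y
... | R = refl
... | L = minOL≡R-intro ys m w

minOL≡R-elim : ∀ xs → minOL xs ≡ R → ∃ λ x → x ∈ xs × oL x ≡ R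
minOL≡R-elim (y ∷ ys) e with oL y in w
... | R = y , here refl , w
... | L with x , m , w′ ← minOL≡R-elim ys e = x , there m , w′

-- The recursion defining oL, read as an inductive characterisation:
-- Left wins moving first iff she has no move or a move after which she wins
-- with Right to move (and dually for Right).
data LeftWinsFirst (K : Game) : Set where
  leftEnd     : LeftEnd K → LeftWinsFirst K
  winningMove : ∀ {k} → k ∈ leftOpts K → oR k ≡ L → LeftWinsFirst K

data RightWinsFirst (K : Game) : Set where
  rightEnd    : RightEnd K → RightWinsFirst K
  winningMove : ∀ {k} → k ∈ rightOpts K → oL k ≡ R → RightWinsFirst K

leftWins : ∀ K → LeftWinsFirst K → oL K ≡ L
leftWins ⟨ [] ∣ _ ⟩ _ = refl
leftWins ⟨ k ∷ ks ∣ _ ⟩ (winningMove m w) = maxOR≡L-intro (k ∷ ks) m w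

leftWinsFirst : ∀ K → oL K ≡ L → LeftWinsFirst K
leftWinsFirst ⟨ [] ∣ _ ⟩ _ = leftEnd refl
leftWinsFirst ⟨ k ∷ ks ∣ _ ⟩ e with _ , m , w ← maxOR≡L-elim (k ∷ ks) e = winningMove m w

rightWins : ∀ K → RightWinsFirst K → oR K ≡ R
rightWins ⟨ _ ∣ [] ⟩ _ = refl
rightWins ⟨ _ ∣ k ∷ ks ⟩ (winningMove m w) = minOL≡R-intro (k ∷ ks) m w

rightWinsFirst : ∀ K → oR K ≡ R → RightWinsFirst K
rightWinsFirst ⟨ _ ∣ [] ⟩ _ = rightEnd refl
rightWinsFirst ⟨ _ ∣ k ∷ ks ⟩ e with _ , m , w ← minOL≡R-elim (k ∷ ks) e = winningMove m w

rightOption-of-oR≡L : ∀ K {k} → oR K ≡ L → k ∈ rightOpts K → oL k ≡ L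
rightOption-of-oR≡L K {k} e m with oL k in w
... | L = refl
... | R with () ← trans (sym e) (rightWins K (winningMove m w))

leftOption-of-oL≡R : ∀ K {k} → oL K ≡ R → k ∈ leftOpts K → oR k ≡ R
leftOption-of-oL≡R K {k} e m with oR k in w
... | R = refl
... | L with () ← trans (sym e) (leftWins K (winningMove m w))

addEach≡map : ∀ gs X → addEach gs X ≡ map (_+G X) gs
addEach≡map [] X = refl
addEach≡map (g ∷ gs) X = cong₂ _∷_ refl (addEach≡map gs X)

addTo≡map : ∀ G xs → addTo G xs ≡ map (G +G_) xs
addTo≡map G [] = refl
addTo≡map G (x ∷ xs) = cong₂ _∷_ refl (addTo≡map G xs)

leftOpts-+ : ∀ G X → leftOpts (G +G X) ≡ map (_+G X) (leftOpts G) ++ map (G +G_) (leftOpts X)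
leftOpts-+ ⟨ GL ∣ _ ⟩ ⟨ XL ∣ _ ⟩ = cong₂ _++_ (addEach≡map GL _) (addTo≡map _ XL)

rightOpts-+ : ∀ G X → rightOpts (G +G X) ≡ map (_+G X) (rightOpts G) ++ map (G +G_) (rightOpts X)
rightOpts-+ ⟨ _ ∣ GR ⟩ ⟨ _ ∣ XR ⟩ = cong₂ _++_ (addEach≡map GR _) (addTo≡map _ XR)

data LeftMove (G X : Game) : Game → Set where
  inG : ∀ {g} → g ∈ leftOpts G → LeftMove G X (g +G X)
  inX : ∀ {x} → x ∈ leftOpts X → LeftMove G X (G +G x)

data RightMove (G X : Game) : Game → Set where
  inG : ∀ {g} → g ∈ rightOpts G → RightMove G X (g +G X)
  inX : ∀ {x} → x ∈ rightOpts X → RightMove G X (G +G x)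

leftMove⁺ : ∀ G X {z} → LeftMove G X z → z ∈ leftOpts (G +G X)
leftMove⁺ G X (inG m) = subst (_ ∈_) (sym (leftOpts-+ G X)) (∈-++⁺ˡ (∈-map⁺ (_+G X) m))
leftMove⁺ G X (inX m) = subst (_ ∈_) (sym (leftOpts-+ G X)) (∈-++⁺ʳ _ (∈-map⁺ (G +G_) m))

leftMove⁻ : ∀ G X {z} → z ∈ leftOpts (G +G X) → LeftMove G X z
leftMove⁻ G X m with ∈-++⁻ (map (_+G X) (leftOpts G)) (subst (_ ∈_) (leftOpts-+ G X) m)
... | inj₁ m′ with _ , g∈ , refl ← ∈-map⁻ (_+G X) m′ = inG g∈
... | inj₂ m′ with _ , x∈ , refl ← ∈-map⁻ (G +G_) m′ = inX x∈

rightMove⁺ : ∀ G X {z} → RightMove G X z → z ∈ rightOpts (G +G X)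
rightMove⁺ G X (inG m) = subst (_ ∈_) (sym (rightOpts-+ G X)) (∈-++⁺ˡ (∈-map⁺ (_+G X) m))
rightMove⁺ G X (inX m) = subst (_ ∈_) (sym (rightOpts-+ G X)) (∈-++⁺ʳ _ (∈-map⁺ (G +G_) m))

rightMove⁻ : ∀ G X {z} → z ∈ rightOpts (G +G X) → RightMove G X z
rightMove⁻ G X m with ∈-++⁻ (map (_+G X) (rightOpts G)) (subst (_ ∈_) (rightOpts-+ G X) m)
... | inj₁ m′ with _ , g∈ , refl ← ∈-map⁻ (_+G X) m′ = inG g∈
... | inj₂ m′ with _ , x∈ , refl ← ∈-map⁻ (G +G_) m′ = inX x∈

leftEnd-+⁻ : ∀ G X → LeftEnd (G +G X) → LeftEnd G × LeftEnd X
leftEnd-+⁻ ⟨ [] ∣ _ ⟩ ⟨ [] ∣ _ ⟩ _ = refl , refl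

leftEnd-+⁺ : ∀ G X → LeftEnd G → LeftEnd X → LeftEnd (G +G X)
leftEnd-+⁺ ⟨ [] ∣ _ ⟩ ⟨ [] ∣ _ ⟩ refl refl = refl

rightEnd-+⁻ : ∀ G X → RightEnd (G +G X) → RightEnd G × RightEnd X
rightEnd-+⁻ ⟨ _ ∣ [] ⟩ ⟨ _ ∣ [] ⟩ _ = refl , refl

rightEnd-+⁺ : ∀ G X → RightEnd G → RightEnd X → RightEnd (G +G X)
rightEnd-+⁺ ⟨ _ ∣ [] ⟩ ⟨ _ ∣ [] ⟩ refl refl = refl

deadEnding-leftOpt : ∀ {X x} → DeadEnding X → x ∈ leftOpts X → DeadEnding x
deadEnding-leftOpt de m H f = de H (viaL m f)

deadEnding-rightOpt : ∀ {X x} → DeadEnding X → x ∈ rightOpts X → DeadEnding x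
deadEnding-rightOpt de m H f = de H (viaR m f)

-- One inductive step towards G ≡E H on each side: the outcome of G + X
-- and H + X with a given player to move agree, provided the outcomes with
-- the other player to move agree after that player's moves in X.
LeftStep : Game → Game → Set
LeftStep G H = ∀ X → DeadEnding X →
  (∀ {x} → x ∈ leftOpts X → oR (G +G x) ≡ oR (H +G x)) → oL (G +G X) ≡ oL (H +G X)

RightStep : Game → Game → Set
RightStep G H = ∀ X → DeadEnding X →
  (∀ {x} → x ∈ rightOpts X → oL (G +G x) ≡ oL (H +G x)) → oR (G +G X) ≡ oR (H +G X)

≡E-by-induction : ∀ G H → LeftStep G H → RightStep G H → G ≡E H
≡E-by-induction G H stepL stepR =
  (λ X de → ≡⇒≤P (sym (proj₁ (agree X de))) , ≡⇒≤P (sym (proj₂ (agree X de)))) ,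
  (λ X de → ≡⇒≤P (proj₁ (agree X de)) , ≡⇒≤P (proj₂ (agree X de)))
  where
  Agree : Game → Set
  Agree X = (oL (G +G X) ≡ oL (H +G X)) × (oR (G +G X) ≡ oR (H +G X))

  mutual
    agree : ∀ X → DeadEnding X → Agree X
    agree X@(⟨ XL ∣ XR ⟩) de =
      stepL X de (λ m → proj₂ (agreeAll XL (deadEnding-leftOpt de) m)) ,
      stepR X de (λ m → proj₁ (agreeAll XR (deadEnding-rightOpt de) m))

    agreeAll : ∀ xs → (∀ {x} → x ∈ xs → DeadEnding x) → ∀ {x} → x ∈ xs → Agree x
    agreeAll (y ∷ ys) de (here refl) = agree y (de (here refl))
    agreeAll (y ∷ ys) de (there m) = agreeAll ys (λ m′ → de (there m′)) m

StrongOR≡R : Game → Set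
StrongOR≡R K = ∀ X → DeadEnding X → RightEnd X → oR (K +G X) ≡ R

strongOL-𝟎 : StrongOL≡L 𝟎
strongOL-𝟎 X _ le = leftWins (𝟎 +G X) (leftEnd (leftEnd-+⁺ 𝟎 X refl le))

strongOR-𝟎 : StrongOR≡R 𝟎
strongOR-𝟎 X _ re = rightWins (𝟎 +G X) (rightEnd (rightEnd-+⁺ 𝟎 X refl re))

-- A Left-end B ≤E G forces ô_L(G) = L, since ô_L(B) = L; in particular
-- every game with an end-reversible Left option has strong Left outcome L.
strongOL-above-leftEnd : ∀ G B → LeftEnd B → B ≤E G → StrongOL≡L G
strongOL-above-leftEnd G B lB B≤G X de le =
  ≤P-L (proj₁ (B≤G X de)) (leftWins (B +G X) (leftEnd (leftEnd-+⁺ B X lB le)))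

strongOR-below-rightEnd : ∀ G D → RightEnd D → D ≥E G → StrongOR≡R G
strongOR-below-rightEnd G D rD D≥G X de re =
  ≤P-R (proj₂ (D≥G X de)) (rightWins (D +G X) (rightEnd (rightEnd-+⁺ D X rD re)))

deleteReversibleLeft : ∀ G H {A B} → B ∈ rightOpts A → LeftEnd B → B ≤E G →
  leftOpts G ⊆ A ∷ leftOpts H → leftOpts H ⊆ leftOpts G → StrongOL≡L H →
  LeftStep G H
deleteReversibleLeft G H {A} {B} B∈A lB B≤G G⊆AH H⊆G strongH X de ih =
  L-ext fromG fromH
  where
  -- After A + X and Right's reply B + X, Left can only move to some B + x.
  reversal : oR (A +G X) ≡ L → oL (H +G X) ≡ L
  reversal w with leftWinsFirst (B +G X) (rightOption-of-oR≡L (A +G X) w (rightMove⁺ A X (inG B∈A)))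
  ... | leftEnd e = strongH X de (proj₂ (leftEnd-+⁻ B X e))
  ... | winningMove m w′ with leftMove⁻ B X m
  ...   | inG b∈B = ⊥-elim (noOption lB b∈B)
  ...   | inX x∈X = leftWins (H +G X) (winningMove (leftMove⁺ H X (inX x∈X))
            (trans (sym (ih x∈X)) (≤P-L (proj₂ (B≤G _ (deadEnding-leftOpt de x∈X))) w′)))

  fromG : oL (G +G X) ≡ L → oL (H +G X) ≡ L
  fromG e with leftWinsFirst (G +G X) e
  ... | leftEnd e′ = strongH X de (proj₂ (leftEnd-+⁻ G X e′))
  ... | winningMove m w with leftMove⁻ G X m
  ...   | inX x∈X = leftWins (H +G X) (winningMove (leftMove⁺ H X (inX x∈X)) (trans (sym (ih x∈X)) w))
  ...   | inG g∈G with G⊆AH g∈G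
  ...     | here refl = reversal w
  ...     | there g∈H = leftWins (H +G X) (winningMove (leftMove⁺ H X (inG g∈H)) w)

  fromH : oL (H +G X) ≡ L → oL (G +G X) ≡ L
  fromH e with leftWinsFirst (H +G X) e
  ... | leftEnd e′ = strongOL-above-leftEnd G B lB B≤G X de (proj₂ (leftEnd-+⁻ H X e′))
  ... | winningMove m w with leftMove⁻ H X m
  ...   | inG h∈H = leftWins (G +G X) (winningMove (leftMove⁺ G X (inG (H⊆G h∈H))) w)
  ...   | inX x∈X = leftWins (G +G X) (winningMove (leftMove⁺ G X (inX x∈X)) (trans (ih x∈X) w))

deleteReversibleRight : ∀ G H {C D} → D ∈ leftOpts C → RightEnd D → D ≥E G →
  rightOpts G ⊆ C ∷ rightOpts H → rightOpts H ⊆ rightOpts G → StrongOR≡R H →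
  RightStep G H
deleteReversibleRight G H {C} {D} D∈C rD D≥G G⊆CH H⊆G strongH X de ih =
  R-ext fromG fromH
  where
  reversal : oL (C +G X) ≡ R → oR (H +G X) ≡ R
  reversal w with rightWinsFirst (D +G X) (leftOption-of-oL≡R (C +G X) w (leftMove⁺ C X (inG D∈C)))
  ... | rightEnd e = strongH X de (proj₂ (rightEnd-+⁻ D X e))
  ... | winningMove m w′ with rightMove⁻ D X m
  ...   | inG d∈D = ⊥-elim (noOption rD d∈D)
  ...   | inX x∈X = rightWins (H +G X) (winningMove (rightMove⁺ H X (inX x∈X))
            (trans (sym (ih x∈X)) (≤P-R (proj₁ (D≥G _ (deadEnding-rightOpt de x∈X))) w′)))

  fromG : oR (G +G X) ≡ R → oR (H +G X) ≡ R
  fromG e with rightWinsFirst (G +G X) e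
  ... | rightEnd e′ = strongH X de (proj₂ (rightEnd-+⁻ G X e′))
  ... | winningMove m w with rightMove⁻ G X m
  ...   | inX x∈X = rightWins (H +G X) (winningMove (rightMove⁺ H X (inX x∈X)) (trans (sym (ih x∈X)) w))
  ...   | inG g∈G with G⊆CH g∈G
  ...     | here refl = reversal w
  ...     | there g∈H = rightWins (H +G X) (winningMove (rightMove⁺ H X (inG g∈H)) w)

  fromH : oR (H +G X) ≡ R → oR (G +G X) ≡ R
  fromH e with rightWinsFirst (H +G X) e
  ... | rightEnd e′ = strongOR-below-rightEnd G D rD D≥G X de (proj₂ (rightEnd-+⁻ H X e′))
  ... | winningMove m w with rightMove⁻ H X m
  ...   | inG h∈H = rightWins (G +G X) (winningMove (rightMove⁺ G X (inG (H⊆G h∈H))) w)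
  ...   | inX x∈X = rightWins (G +G X) (winningMove (rightMove⁺ G X (inX x∈X)) (trans (ih x∈X) w))

sameRightOptions : ∀ G H → rightOpts G ≡ rightOpts H → RightStep G H
sameRightOptions G H same X _ ih =
  R-ext (transfer G H same (λ m → sym (ih m))) (transfer H G (sym same) ih)
  where
  transfer : ∀ K K′ → rightOpts K ≡ rightOpts K′ →
    (∀ {x} → x ∈ rightOpts X → oL (K′ +G x) ≡ oL (K +G x)) →
    oR (K +G X) ≡ R → oR (K′ +G X) ≡ R
  transfer K K′ same′ ih′ e with rightWinsFirst (K +G X) e
  ... | rightEnd e′ with rK , rX ← rightEnd-+⁻ K X e′ =
    rightWins (K′ +G X) (rightEnd (rightEnd-+⁺ K′ X (trans (sym same′) rK) rX))
  ... | winningMove m w with rightMove⁻ K X m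
  ...   | inG k∈K =
    rightWins (K′ +G X) (winningMove (rightMove⁺ K′ X (inG (subst (_ ∈_) same′ k∈K))) w)
  ...   | inX x∈X =
    rightWins (K′ +G X) (winningMove (rightMove⁺ K′ X (inX x∈X)) (trans (ih′ x∈X) w))

-- If ô_L(G) = L but A is not fundamental, deleting A keeps ô_L = L
-- (outcomes being decidable, ô_L(H) ≠ R means ô_L(H) = L).
strongOL-after-nonFundamental : ∀ G A → A ∈ leftOpts G → StrongOL≡L G →
  ¬ Fundamental G A → StrongOL≡L (removeLeft G A)
strongOL-after-nonFundamental G A A∈G strongG notFund X de le with oL (removeLeft G A +G X) in w
... | L = refl
... | R = ⊥-elim (notFund (A∈G , strongG , X , de , le , w))

removeLeft-⊇ : ∀ G A → leftOpts G ⊆ A ∷ leftOpts (removeLeft G A)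
removeLeft-⊇ ⟨ GL ∣ _ ⟩ A {g} g∈G with g ≟G A
... | yes refl = here refl
... | no g≢A = there (∈-filter⁺ (λ x → ¬? (x ≟G A)) g∈G g≢A)

removeLeft-⊆ : ∀ G A → leftOpts (removeLeft G A) ⊆ leftOpts G
removeLeft-⊆ ⟨ GL ∣ _ ⟩ A = filter-⊆ (λ x → ¬? (x ≟G A)) GL

removeLeft-rightOpts : ∀ G A → rightOpts G ≡ rightOpts (removeLeft G A)
removeLeft-rightOpts ⟨ _ ∣ _ ⟩ A = refl

mainTheorem8 : (G A : Game) → DeadEnding G → EndReversibleL G A →
    ((¬ Fundamental G A) → DeadEnding (removeLeft G A) → G ≡E removeLeft G A)
    × ((C : Game) → G ≡ ⟨ A ∷ [] ∣ C ∷ [] ⟩ → EndReversibleR G C → G ≡E 𝟎)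
mainTheorem8 G A _ (A∈G , B , B∈A , lB , B≤G) = part1 , part2
  where
  part1 : ¬ Fundamental G A → DeadEnding (removeLeft G A) → G ≡E removeLeft G A
  part1 notFund _ = ≡E-by-induction G H
    (deleteReversibleLeft G H B∈A lB B≤G (removeLeft-⊇ G A) (removeLeft-⊆ G A)
      (strongOL-after-nonFundamental G A A∈G (strongOL-above-leftEnd G B lB B≤G) notFund))
    (sameRightOptions G H (removeLeft-rightOpts G A))
    where H = removeLeft G A

  part2 : (C : Game) → G ≡ ⟨ A ∷ [] ∣ C ∷ [] ⟩ → EndReversibleR G C → G ≡E 𝟎
  part2 C refl (_ , D , D∈C , rD , D≥G) = ≡E-by-induction G 𝟎
    (deleteReversibleLeft G 𝟎 B∈A lB B≤G (λ g∈G → g∈G) (λ ()) strongOL-𝟎)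
    (deleteReversibleRight G 𝟎 D∈C rD D≥G (λ g∈G → g∈G) (λ ()) strongOR-𝟎)
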